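{- (In a suitable set-theoretic meta theory.) Let $T$ be a coded normal dilator. If an ordinal $\alpha$ (viewed as a well-order) and an order embedding $\xi:D^T(\alpha)\to\alpha$ form a fixed point of $T$, then $\alpha=\operatorname{otp}(D^T(\alpha))$.
   Context: The category of natural numbers has objects $n=\{0,\dots,n-1\}$ and strictly increasing maps. For a finite linear order $a$, $|a|$ is its cardinality and $\operatorname{en}_a$ its increasing enumeration; for an embedding $f:a\to b$ of finite orders, $|f|$ is the unique map with $f\circ\operatorname{en}_a=\operatorname{en}_b\circ|f|$. A coded prae-dilator: functor $T$ from the category of natural numbers to linear orders (fields $\subseteq\mathbb N$) with a natural transformation $\operatorname{supp}^T$ to the finite-subset functor such that each $\sigma\in T(n)$ lies in the range of $T(e)$, $e:|\operatorname{supp}^T_n(\sigma)|\to n$ the embedding with range $\operatorname{supp}^T_n(\sigma)$. For a linear order $X$: $D^T(X)=\{\langle a,\sigma\rangle\mid a\subseteq X\text{ finite},\sigma\in T(|a|),\operatorname{supp}^T_{|a|}(\sigma)=|a|\}$ with $\langle a,\sigma\rangle<\langle b,\tau\rangle$ iff $T(|\iota_a^{a\cup b}|)(\sigma)<T(|\iota_b^{a\cup b}|)(\tau)$ ($\iota$ inclusions into $a\cup b$). $T$ is a coded dilator if $D^T(X)$ is well-founded for all well-orders $X$ with field $\subseteq\mathbb N$ (equivalently for all well-orders). Normal: there is a natural family of embeddings $\mu^T_n:n\to T(n)$ with $\sigma<_{T(n)}\mu^T_n(m)\iff\operatorname{supp}^T_n(\sigma)\subseteq\{0,\dots,m-1\}$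 for $m<n$. A fixed point of $T$ is a linear order $X$ with an order embedding $D^T(X)\to X$. $\operatorname{otp}$ denotes order type. -}

module Defs where

open import Level using (0ℓ)
open import Data.Nat as ℕ using (ℕ)
open import Data.Fin as Fin using (Fin; toℕ)
open import Data.Fin.Subset using (Subset; _∈_; ⊤)
open import Data.Bool using (Bool; T)
open import Data.Product using (Σ; _×_; _,_; ∃; ∃-syntax)
open import Data.Sum using (_⊎_)
open import Relation.Nullary using (¬_)
open import Relation.Binary using (Rel; Trichotomous; Transitive; IsStrictTotalOrder)
open import Relation.Binary.PropositionalEquality using (_≡_; subst)
open import Induction.WellFounded using (WellFounded)
open import Function using (_⇔_)

-- The category of natural numbers: objects n = {0,…,n-1} (Fin n),
-- morphisms strictly increasing maps.

record Mor (n m : ℕ) : Set where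
  field
    fun  : Fin n → Fin m
    mono : ∀ {i j : Fin n} → i Fin.< j → fun i Fin.< fun j
open Mor public

idMor : ∀ {n} → Mor n n
idMor = record { fun = λ i → i ; mono = λ p → p }

_∘M_ : ∀ {n m k} → Mor m k → Mor n m → Mor n k
g ∘M f = record { fun = λ i → fun g (fun f i) ; mono = λ p → mono g (mono f p) }

-- Coded prae-dilators.  T(n) is a linear order whose field is a subset
-- of ℕ: field  Fld n σ,  order  Lt n σ τ.

record PraeDilator : Set₁ where
  field
    Fld   : ℕ → ℕ → Set
    Lt    : ℕ → ℕ → ℕ → Set
    Lt-fld   : ∀ {n σ τ} → Lt n σ τ → Fld n σ × Fld n τ
    Lt-irr   : ∀ {n σ} → ¬ Lt n σ σ
    Lt-trans : ∀ {n σ τ ρ} → Lt n σ τ → Lt n τ ρ → Lt n σ ρ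
    Lt-conn  : ∀ {n σ τ} → Fld n σ → Fld n τ → Lt n σ τ ⊎ σ ≡ τ ⊎ Lt n τ σ
    map      : ∀ {n m} → Mor n m → ℕ → ℕ
    map-fld  : ∀ {n m} (f : Mor n m) {σ} → Fld n σ → Fld m (map f σ)
    map-mono : ∀ {n m} (f : Mor n m) {σ τ} → Lt n σ τ → Lt m (map f σ) (map f τ)
    map-id   : ∀ {n σ} → Fld n σ → map (idMor {n}) σ ≡ σ
    map-∘    : ∀ {n m k} (g : Mor m k) (f : Mor n m) {σ} → Fld n σ →
               map (g ∘M f) σ ≡ map g (map f σ)
    -- supports: natural transformation to the finite-subset functor
    supp     : (n : ℕ) → ℕ → Subset n
    supp-nat : ∀ {n m} (f : Mor n m) {σ} → Fld n σ → ∀ (j : Fin m) →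
               (j ∈ supp m (map f σ)) ⇔ (∃[ i ] (i ∈ supp n σ × fun f i ≡ j))
    -- support condition: σ is in the range of T(e), where e : |supp σ| → n
    -- is the (unique) strictly increasing map with range supp σ
    supp-cond : ∀ {n σ} → Fld n σ →
                Σ ℕ λ k → Σ (Mor k n) λ e →
                  (∀ (j : Fin n) → (j ∈ supp n σ) ⇔ (∃[ i ] fun e i ≡ j)) ×
                  (∃[ σ₀ ] (Fld k σ₀ × map e σ₀ ≡ σ))

IsWellOrder : {A : Set} → Rel A 0ℓ → Set
IsWellOrder _<_ = IsStrictTotalOrder _≡_ _<_ × WellFounded _<_

-- D^T(X) for a linear order X = (A, _<_).
-- A finite subset a ⊆ X is given by its increasing enumeration
-- en_a : Fin |a| → A.

module _ (P : PraeDilator) {A : Set} (_<_ : Rel A 0ℓ) where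
  open PraeDilator P

  record DT : Set where
    constructor ⟨_,_,_,_,_,_⟩
    field
      size   : ℕ
      en     : Fin size → A
      en-inc : ∀ {i j} → i Fin.< j → en i < en j
      σ      : ℕ
      σ-fld  : Fld size σ
      σ-supp : supp size σ ≡ ⊤
  open DT public

  -- ⟨a,σ⟩ < ⟨b,τ⟩  iff  T(|ι_a^{a∪b}|)(σ) < T(|ι_b^{a∪b}|)(τ).
  -- Here c is the increasing enumeration of a ∪ b and f = |ι_a^{a∪b}|,
  -- g = |ι_b^{a∪b}| are determined by  en_c ∘ f = en_a,  en_c ∘ g = en_b,
  -- with every element of c coming from a or from b.
  _<D_ : DT → DT → Set
  d <D e =
    Σ ℕ λ k → Σ (Fin k → A) λ c → (∀ {i j} → i Fin.< j → c i < c j) ×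
    Σ (Mor (size d) k) λ f → Σ (Mor (size e) k) λ g →
      (∀ i → c (fun f i) ≡ en d i) ×
      (∀ i → c (fun g i) ≡ en e i) ×
      (∀ l → (∃[ i ] fun f i ≡ l) ⊎ (∃[ i ] fun g i ≡ l)) ×
      Lt k (map f (σ d)) (map g (σ e))

  _≈D_ : DT → DT → Set
  d ≈D e = Σ (size d ≡ size e) λ p →
             (∀ i → en d i ≡ en e (subst Fin p i)) × σ d ≡ σ e

-- Coded dilators: D^T(X) well-founded for every well-order X whose
-- field is a subset of ℕ (field given by F : ℕ → Bool, order R on ℕ).

Field : (ℕ → Bool) → Set
Field F = Σ ℕ λ n → T (F n)

restrict : (F : ℕ → Bool) → Rel ℕ 0ℓ → Rel (Field F) 0ℓ
restrict F R (m , _) (n , _) = R m n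

IsDilator : PraeDilator → Set₁
IsDilator P = ∀ (F : ℕ → Bool) (R : Rel ℕ 0ℓ) →
  IsWellOrder (restrict F R) → WellFounded (_<D_ P (restrict F R))

IsNormal : PraeDilator → Set
IsNormal P = Σ ((n : ℕ) → Fin n → ℕ) λ μ →
    (∀ n m → Fld n (μ n m))
  × (∀ n {m m'} → m Fin.< m' → Lt n (μ n m) (μ n m'))
  × (∀ {n k} (f : Mor n k) m → map f (μ n m) ≡ μ k (fun f m))
  × (∀ n {σ} → Fld n σ → ∀ (m : Fin n) →
       Lt n σ (μ n m) ⇔ (∀ j → j ∈ supp n σ → toℕ j ℕ.< toℕ m))
  where open PraeDilator P

IsOrderEmbedding : {A B : Set} (_<A_ : Rel A 0ℓ) (_<B_ : Rel B 0ℓ) → (A → B) → Set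
IsOrderEmbedding _<A_ _<B_ h = ∀ {x y} → x <A y → h x <B h y

record OrderIso {A B : Set} (_<A_ : Rel A 0ℓ) (_<B_ : Rel B 0ℓ)
                (_≈B_ : Rel B 0ℓ) : Set where
  field
    to      : A → B
    from    : B → A
    to-mono   : IsOrderEmbedding _<A_ _<B_ to
    from-mono : IsOrderEmbedding _<B_ _<A_ from
    from-to : ∀ x → from (to x) ≡ x
    to-from : ∀ y → to (from y) ≈B y

module Submission where

-- Let X = (A, <) be the well-order and ξ : D^T(X) → X the given
-- embedding.  Normality yields a converse embedding  x ↦ ⟨{x}, μ₁(0)⟩  of X
-- into D^T(X).  Two well-orders that embed into each other are isomorphic,
-- which is the theorem.
--
-- Well-foundedness of D^T(X) is inherited from X along ξ.

open import Level using (0ℓ)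
open import Relation.Binary using (Rel; IsStrictTotalOrder; tri<; tri≈; tri>)
open import Relation.Binary.PropositionalEquality
  using (_≡_; refl; sym; trans; cong; subst; subst₂; module ≡-Reasoning)
open import Relation.Binary.Construct.On as On using ()
open import Relation.Nullary using (¬_; yes; no)
open import Data.Product using (Σ; _×_; _,_; proj₁; proj₂; ∃-syntax)
open import Data.Sum using (_⊎_; inj₁; inj₂; swap)
open import Data.Empty using (⊥-elim)
open import Data.Bool using (true; false)
open import Data.Vec using ([]; _∷_)
import Data.Vec.Functional as V
open import Data.Nat as ℕ using (ℕ; zero; suc; z≤n; s≤s)
import Data.Nat.Properties as ℕ
open import Data.Fin as Fin using (Fin; toℕ; zero; suc; inject₁)
import Data.Fin.Properties as Fin
open import Data.Fin.Subset using (Subset; _∈_; ⊤)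
open import Data.Fin.Subset.Properties using (∈⊤)
open import Function using (_∘_; _⇔_; mk⇔; Equivalence)
open import Induction.WellFounded using (WellFounded; Acc; acc; module All; module Subrelation)
open import Axiom.ExcludedMiddle using (ExcludedMiddle)
open import Axiom.DoubleNegationElimination using (em⇒dne)
open import Defs

minimal-counterexample : ExcludedMiddle 0ℓ → {X : Set} {R : Rel X 0ℓ} → WellFounded R →
  (Q : X → Set) → ¬ (∀ x → Q x) → Σ X λ x → ¬ Q x × (∀ y → R y x → Q y)
minimal-counterexample lem wf Q ¬all = em⇒dne lem λ ¬minimal →
  ¬all (All.wfRec wf 0ℓ Q λ x below →
          em⇒dne lem λ ¬Qx → ¬minimal (x , ¬Qx , λ y y<x → below y<x))

no-descent : {X : Set} {R : Rel X 0ℓ} → WellFounded R →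
  (φ : X → X) → IsOrderEmbedding R R φ → ∀ x → ¬ R (φ x) x
no-descent {R = R} wf φ φ-mono x = go x (wf x)
  where
  go : ∀ x → Acc R x → ¬ R (φ x) x
  go x (acc rs) φx<x = go (φ x) (rs φx<x) (φ-mono φx<x)

-- Classically the two are then isomorphic.
module Comparison (lem : ExcludedMiddle 0ℓ)
  {A : Set} (_<_ : Rel A 0ℓ) (A-order : IsStrictTotalOrder _≡_ _<_) (A-wf : WellFounded _<_)
  {B : Set} (_⊏_ : Rel B 0ℓ) (_≈_ : Rel B 0ℓ)
  (B-compare : ∀ x y → x ⊏ y ⊎ x ≈ y ⊎ y ⊏ x)
  (≈-sym : ∀ {x y} → x ≈ y → y ≈ x)
  (⊏-respˡ : ∀ {x x′ y} → x ≈ x′ → x ⊏ y → x′ ⊏ y)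
  (⊏-respʳ : ∀ {x y y′} → y ≈ y′ → x ⊏ y → x ⊏ y′)
  (ι : A → B) (ι-mono : IsOrderEmbedding _<_ _⊏_ ι)
  (ξ : B → A) (ξ-mono : IsOrderEmbedding _⊏_ _<_ ξ) where

  open IsStrictTotalOrder A-order using (compare; irrefl; asym)

  ⊏-irrefl : ∀ {x} → ¬ x ⊏ x
  ⊏-irrefl x⊏x = irrefl refl (ξ-mono x⊏x)

  ⊏-asym : ∀ {x y} → x ⊏ y → ¬ y ⊏ x
  ⊏-asym x⊏y y⊏x = asym (ξ-mono x⊏y) (ξ-mono y⊏x)

  B-wf : WellFounded _⊏_
  B-wf = Subrelation.wellFounded ξ-mono (On.wellFounded ξ A-wf)

  -- Similar a b: the initial segment of A below a is isomorphic to the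
  -- initial segment of B below b, given by a back-and-forth condition.
  data Similar : A → B → Set where
    similar : ∀ {a b} →
      (∀ a′ → a′ < a → Σ B λ b′ → b′ ⊏ b × Similar a′ b′) →
      (∀ b′ → b′ ⊏ b → Σ A λ a′ → a′ < a × Similar a′ b′) →
      Similar a b

  -- If similarity is functional below a, then a point b similar to a
  -- cannot lie below another point b′ similar to a: going back from b to
  -- some a′ < a and forth again would give a partner b″ ⊏ b of a′ with b″ ≈ b.
  not-below-partner : ∀ {a b b′} →
    (∀ {a′} → a′ < a → ∀ {c c′} → Similar a′ c → Similar a′ c′ → c ≈ c′) →
    Similar a b → Similar a b′ → ¬ b ⊏ b′
  not-below-partner functional-below (similar fwd _) (similar _ bwd′) b⊏b′ =
    let a′ , a′<a , a′∼b = bwd′ _ b⊏b′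
        b″ , b″⊏b , a′∼b″ = fwd a′ a′<a
    in ⊏-irrefl (⊏-respˡ (functional-below a′<a a′∼b″ a′∼b) b″⊏b)

  similar-functional : ∀ {a b b′} → Similar a b → Similar a b′ → b ≈ b′
  similar-functional {a} = go a (A-wf a)
    where
    go : ∀ a → Acc _<_ a → ∀ {b b′} → Similar a b → Similar a b′ → b ≈ b′
    go a (acc rs) {b} {b′} a∼b a∼b′ with B-compare b b′
    ... | inj₁ b⊏b′        = ⊥-elim (not-below-partner (λ a′<a → go _ (rs a′<a)) a∼b a∼b′ b⊏b′)
    ... | inj₂ (inj₁ b≈b′) = b≈b′
    ... | inj₂ (inj₂ b′⊏b) = ⊥-elim (not-below-partner (λ a′<a → go _ (rs a′<a)) a∼b′ a∼b b′⊏b)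

  similar-mono : ∀ {a a′ b b′} → Similar a b → Similar a′ b′ → a′ < a → b′ ⊏ b
  similar-mono (similar fwd _) a′∼b′ a′<a with fwd _ a′<a
  ... | b″ , b″⊏b , a′∼b″ = ⊏-respˡ (similar-functional a′∼b″ a′∼b′) b″⊏b

  similar-reflect : ∀ {a a′ b b′} → Similar a b → Similar a′ b′ → b′ ⊏ b → a′ < a
  similar-reflect {a} {a′} a∼b a′∼b′ b′⊏b with compare a′ a
  ... | tri< a′<a _ _ = a′<a
  ... | tri≈ _ refl _ = ⊥-elim (⊏-irrefl (⊏-respˡ (similar-functional a′∼b′ a∼b) b′⊏b))
  ... | tri> _ _ a<a′ = ⊥-elim (⊏-asym b′⊏b (similar-mono a′∼b′ a∼b a<a′))

  similar-injective : ∀ {a a′ b} → Similar a b → Similar a′ b → a ≡ a′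
  similar-injective {a} {a′} a∼b a′∼b with compare a a′
  ... | tri< a<a′ _ _ = ⊥-elim (⊏-irrefl (similar-mono a′∼b a∼b a<a′))
  ... | tri≈ _ a≡a′ _ = a≡a′
  ... | tri> _ _ a′<a = ⊥-elim (⊏-irrefl (similar-mono a∼b a′∼b a′<a))

  similar-resp : ∀ {a b b′} → Similar a b → b ≈ b′ → Similar a b′
  similar-resp (similar fwd bwd) b≈b′ =
    similar (λ a′ a′<a → let b″ , b″⊏b , s = fwd a′ a′<a in b″ , ⊏-respʳ b≈b′ b″⊏b , s)
            (λ b″ b″⊏b′ → bwd b″ (⊏-respʳ (≈-sym b≈b′) b″⊏b′))

  Dom : A → Set
  Dom a = Σ B (Similar a)

  Ran : B → Set
  Ran b = Σ A λ a → Similar a b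

  below-missing-ran : ∀ {b₀} → ¬ Ran b₀ → ∀ {a b} → Similar a b → b ⊏ b₀
  below-missing-ran {b₀} b₀∉ran {a} {b} s@(similar _ bwd) with B-compare b b₀
  ... | inj₁ b⊏b₀ = b⊏b₀
  ... | inj₂ (inj₁ b≈b₀) = ⊥-elim (b₀∉ran (a , similar-resp s b≈b₀))
  ... | inj₂ (inj₂ b₀⊏b) = ⊥-elim (b₀∉ran (let a′ , _ , s′ = bwd b₀ b₀⊏b in a′ , s′))

  below-missing-dom : ∀ {a₀} → ¬ Dom a₀ → ∀ {a b} → Similar a b → a < a₀
  below-missing-dom {a₀} a₀∉dom {a} {b} s@(similar fwd _) with compare a a₀
  ... | tri< a<a₀ _ _ = a<a₀
  ... | tri≈ _ refl _ = ⊥-elim (a₀∉dom (b , s))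
  ... | tri> _ _ a₀<a = ⊥-elim (a₀∉dom (let b′ , _ , s′ = fwd a₀ a₀<a in b′ , s′))

  missing-minima-similar : ∀ {a₀ b₀} → ¬ Dom a₀ → ¬ Ran b₀ →
    (∀ a → a < a₀ → Dom a) → (∀ b → b ⊏ b₀ → Ran b) → Similar a₀ b₀
  missing-minima-similar a₀∉dom b₀∉ran dom-below ran-below = similar
    (λ a a<a₀ → let b , s = dom-below a a<a₀ in b , below-missing-ran b₀∉ran s , s)
    (λ b b⊏b₀ → let a , s = ran-below b b⊏b₀ in a , below-missing-dom a₀∉dom s , s)

  dom-or-ran-total : (∀ a → Dom a) ⊎ (∀ b → Ran b)
  dom-or-ran-total with lem {∀ a → Dom a} | lem {∀ b → Ran b}
  ... | yes dom | _ = inj₁ dom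
  ... | no _ | yes ran = inj₂ ran
  ... | no ¬dom | no ¬ran
    with minimal-counterexample lem A-wf Dom ¬dom | minimal-counterexample lem B-wf Ran ¬ran
  ...   | a₀ , a₀∉dom , dom-below | b₀ , b₀∉ran , ran-below =
          ⊥-elim (a₀∉dom (b₀ , missing-minima-similar a₀∉dom b₀∉ran dom-below ran-below))

  -- A total domain forces a total range: if b₀ were unmatched, all partners
  -- would lie below b₀ and  ξ ∘ partner  would move ξ b₀ down.
  ran-total : (∀ a → Dom a) → ∀ b → Ran b
  ran-total dom b₀ = em⇒dne lem λ b₀∉ran →
    no-descent A-wf (λ a → ξ (proj₁ (dom a)))
      (λ a<a′ → ξ-mono (similar-mono (proj₂ (dom _)) (proj₂ (dom _)) a<a′))
      (ξ b₀) (ξ-mono (below-missing-ran b₀∉ran (proj₂ (dom (ξ b₀)))))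

  -- Symmetrically, using ι: if a₀ were unmatched,  partner ∘ ι  would move a₀ down.
  dom-total : (∀ b → Ran b) → ∀ a → Dom a
  dom-total ran a₀ = em⇒dne lem λ a₀∉dom →
    no-descent A-wf (λ a → proj₁ (ran (ι a)))
      (λ a<a′ → similar-reflect (proj₂ (ran _)) (proj₂ (ran _)) (ι-mono a<a′))
      a₀ (below-missing-dom a₀∉dom (proj₂ (ran (ι a₀))))

  isomorphic : OrderIso _<_ _⊏_ _≈_
  isomorphic = record
    { to        = λ a → proj₁ (dom a)
    ; from      = λ b → proj₁ (ran b)
    ; to-mono   = λ a<a′ → similar-mono (proj₂ (dom _)) (proj₂ (dom _)) a<a′
    ; from-mono = λ b⊏b′ → similar-reflect (proj₂ (ran _)) (proj₂ (ran _)) b⊏b′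
    ; from-to   = λ a → similar-injective (proj₂ (ran (proj₁ (dom a)))) (proj₂ (dom a))
    ; to-from   = λ b → similar-functional (proj₂ (dom (proj₁ (ran b)))) (proj₂ (ran b))
    }
    where
    totals : (∀ a → Dom a) × (∀ b → Ran b)
    totals with dom-or-ran-total
    ... | inj₁ dom = dom , ran-total dom
    ... | inj₂ ran = dom-total ran , ran
    dom : ∀ a → Dom a
    dom = proj₁ totals
    ran : ∀ b → Ran b
    ran = proj₂ totals

Increasing : ∀ {n k} → (Fin n → Fin k) → Set
Increasing f = ∀ {i j} → i Fin.< j → f i Fin.< f j

increasing-injective : ∀ {n k} {f : Fin n → Fin k} → Increasing f → ∀ {i j} → f i ≡ f j → i ≡ j
increasing-injective f-inc {i} {j} fi≡fj with Fin.<-cmp i j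
... | tri< i<j _ _ = ⊥-elim (ℕ.<-irrefl (cong toℕ fi≡fj) (f-inc i<j))
... | tri≈ _ i≡j _ = i≡j
... | tri> _ _ j<i = ⊥-elim (ℕ.<-irrefl (cong toℕ (sym fi≡fj)) (f-inc j<i))

increasing-inflationary : ∀ {n k} (f : Fin n → Fin k) → Increasing f → ∀ i → toℕ i ℕ.≤ toℕ (f i)
increasing-inflationary f f-inc zero = z≤n
increasing-inflationary {suc n} f f-inc (suc i) =
  ℕ.≤-<-trans (increasing-inflationary (f ∘ inject₁) (f-inc ∘ inject₁-<) i) (f-inc i<suc-i)
  where
  inject₁-< : ∀ {i j : Fin n} → i Fin.< j → inject₁ i Fin.< inject₁ j
  inject₁-< {i} {j} = subst₂ ℕ._<_ (sym (Fin.toℕ-inject₁ i)) (sym (Fin.toℕ-inject₁ j))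
  i<suc-i : inject₁ i Fin.< suc i
  i<suc-i = subst (ℕ._< suc (toℕ i)) (sym (Fin.toℕ-inject₁ i)) (ℕ.n<1+n (toℕ i))

-- An increasing surjection Fin n → Fin k is the identity: n ≡ k and f fixes
-- every index.  Its inverse is increasing too, so both are inflationary.
increasing-surjection-is-id : ∀ {n k} (f : Fin n → Fin k) → Increasing f →
  (∀ l → ∃[ i ] f i ≡ l) → n ≡ k × (∀ i → toℕ (f i) ≡ toℕ i)
increasing-surjection-is-id {n} {k} f f-inc f-onto =
  ℕ.≤-antisym (Fin.injective⇒≤ (increasing-injective f-inc)) (Fin.injective⇒≤ h-injective) ,
  λ i → ℕ.≤-antisym
    (subst (λ j → toℕ (f i) ℕ.≤ toℕ j) (h∘f i) (increasing-inflationary h h-inc (f i)))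
    (increasing-inflationary f f-inc i)
  where
  h : Fin k → Fin n
  h l = proj₁ (f-onto l)
  f∘h : ∀ l → f (h l) ≡ l
  f∘h l = proj₂ (f-onto l)
  h∘f : ∀ i → h (f i) ≡ i
  h∘f i = increasing-injective f-inc (f∘h (f i))
  h-injective : ∀ {l l′} → h l ≡ h l′ → l ≡ l′
  h-injective {l} {l′} hl≡hl′ = trans (sym (f∘h l)) (trans (cong f hl≡hl′) (f∘h l′))
  h-inc : Increasing h
  h-inc {l} {l′} l<l′ with Fin.<-cmp (h l) (h l′)
  ... | tri< hl<hl′ _ _ = hl<hl′
  ... | tri≈ _ hl≡hl′ _ = ⊥-elim (ℕ.<-irrefl (cong toℕ (h-injective hl≡hl′)) l<l′)
  ... | tri> _ _ hl′<hl = ⊥-elim (ℕ.<-asym l<l′ (subst₂ Fin._<_ (f∘h l′) (f∘h l) (f-inc hl′<hl)))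

toℕ-subst : ∀ {n m} (p : n ≡ m) (i : Fin n) → toℕ (subst Fin p i) ≡ toℕ i
toℕ-subst refl i = refl

empty-mor : ∀ {k} → Mor 0 k
empty-mor = record { fun = λ () ; mono = λ { {()} } }

shift-mor : ∀ {n k} → Mor n k → Mor n (suc k)
shift-mor f = record { fun = suc ∘ fun f ; mono = λ i<j → s≤s (mono f i<j) }

extend-mor : ∀ {n k} → Mor n k → Mor (suc n) (suc k)
extend-mor f = record { fun = zero V.∷ (suc ∘ fun f) ; mono = extend-mono }
  where
  extend-mono : Increasing (zero V.∷ (suc ∘ fun f))
  extend-mono {zero}  {zero}  ()
  extend-mono {zero}  {suc j} _ = s≤s z≤n
  extend-mono {suc i} {zero}  ()
  extend-mono {suc i} {suc j} (s≤s i<j) = s≤s (mono f i<j)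

module Unions {A : Set} {_<_ : Rel A 0ℓ} (A-order : IsStrictTotalOrder _≡_ _<_) where

  open IsStrictTotalOrder A-order using (compare) renaming (trans to <-trans)

  Sorted : ∀ {n} → (Fin n → A) → Set
  Sorted a = ∀ {i j} → i Fin.< j → a i < a j

  record Union {n m} (a : Fin n → A) (b : Fin m → A) : Set where
    field
      k      : ℕ
      c      : Fin k → A
      c-inc  : Sorted c
      f      : Mor n k
      g      : Mor m k
      c∘f    : ∀ i → c (fun f i) ≡ a i
      c∘g    : ∀ i → c (fun g i) ≡ b i
      covers : ∀ l → (∃[ i ] fun f i ≡ l) ⊎ (∃[ i ] fun g i ≡ l)

  swap-union : ∀ {n m} {a : Fin n → A} {b : Fin m → A} → Union a b → Union b a
  swap-union U = record
    { k = k ; c = c ; c-inc = c-inc ; f = g ; g = f ; c∘f = c∘g ; c∘g = c∘f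
    ; covers = λ l → swap (covers l) }
    where open Union U

  union-lower-bound : ∀ {n m} {a : Fin n → A} {b : Fin m → A} (U : Union a b) → ∀ x →
    (∀ i → x < a i) → (∀ j → x < b j) → ∀ l → x < Union.c U l
  union-lower-bound U x x<a x<b l with Union.covers U l
  ... | inj₁ (i , refl) = subst (x <_) (sym (Union.c∘f U i)) (x<a i)
  ... | inj₂ (j , refl) = subst (x <_) (sym (Union.c∘g U j)) (x<b j)

  prepend-sorted : ∀ {k} x (c : Fin k → A) → Sorted c → (∀ l → x < c l) → Sorted (x V.∷ c)
  prepend-sorted x c c-inc x<c {zero}  {zero}  ()
  prepend-sorted x c c-inc x<c {zero}  {suc j} _ = x<c j
  prepend-sorted x c c-inc x<c {suc i} {zero}  ()
  prepend-sorted x c c-inc x<c {suc i} {suc j} (s≤s i<j) = c-inc i<j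

  prepend-left : ∀ {n m} (a : Fin (suc n) → A) (b : Fin m → A) → Sorted a →
    (∀ j → a zero < b j) → Union (a ∘ suc) b → Union a b
  prepend-left a b a-inc a₀<b U = record
    { k = suc k ; c = a zero V.∷ c
    ; c-inc = prepend-sorted (a zero) c c-inc
                (union-lower-bound U (a zero) (λ _ → a-inc (s≤s z≤n)) a₀<b)
    ; f = extend-mor f ; g = shift-mor g
    ; c∘f = λ { zero → refl ; (suc i) → c∘f i } ; c∘g = c∘g
    ; covers = λ { zero → inj₁ (zero , refl) ; (suc l) → lift (covers l) } }
    where
    open Union U
    lift : ∀ {l} → (∃[ i ] fun f i ≡ l) ⊎ (∃[ j ] fun g j ≡ l) →
      (∃[ i ] fun (extend-mor f) i ≡ suc l) ⊎ (∃[ j ] fun (shift-mor g) j ≡ suc l)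
    lift (inj₁ (i , refl)) = inj₁ (suc i , refl)
    lift (inj₂ (j , refl)) = inj₂ (j , refl)

  prepend-both : ∀ {n m} (a : Fin (suc n) → A) (b : Fin (suc m) → A) → Sorted a → Sorted b →
    a zero ≡ b zero → Union (a ∘ suc) (b ∘ suc) → Union a b
  prepend-both a b a-inc b-inc a₀≡b₀ U = record
    { k = suc k ; c = a zero V.∷ c
    ; c-inc = prepend-sorted (a zero) c c-inc
                (union-lower-bound U (a zero) (λ _ → a-inc (s≤s z≤n))
                  (λ _ → subst (_< _) (sym a₀≡b₀) (b-inc (s≤s z≤n))))
    ; f = extend-mor f ; g = extend-mor g
    ; c∘f = λ { zero → refl ; (suc i) → c∘f i }
    ; c∘g = λ { zero → a₀≡b₀ ; (suc j) → c∘g j }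
    ; covers = λ { zero → inj₁ (zero , refl) ; (suc l) → lift (covers l) } }
    where
    open Union U
    lift : ∀ {l} → (∃[ i ] fun f i ≡ l) ⊎ (∃[ j ] fun g j ≡ l) →
      (∃[ i ] fun (extend-mor f) i ≡ suc l) ⊎ (∃[ j ] fun (extend-mor g) j ≡ suc l)
    lift (inj₁ (i , refl)) = inj₁ (suc i , refl)
    lift (inj₂ (j , refl)) = inj₂ (suc j , refl)

  below-head : ∀ {k} (c : Fin (suc k) → A) → Sorted c → ∀ {x} → x < c zero → ∀ l → x < c l
  below-head c c-inc x<c₀ zero = x<c₀
  below-head c c-inc x<c₀ (suc l) = <-trans x<c₀ (c-inc (s≤s z≤n))

  union : ∀ {n m} (a : Fin n → A) (b : Fin m → A) → Sorted a → Sorted b → Union a b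
  union {zero} a b a-inc b-inc = record
    { k = _ ; c = b ; c-inc = b-inc ; f = empty-mor ; g = idMor
    ; c∘f = λ () ; c∘g = λ _ → refl ; covers = λ l → inj₂ (l , refl) }
  union {suc n} {zero} a b a-inc b-inc = record
    { k = _ ; c = a ; c-inc = a-inc ; f = idMor ; g = empty-mor
    ; c∘f = λ _ → refl ; c∘g = λ () ; covers = λ l → inj₁ (l , refl) }
  union {suc n} {suc m} a b a-inc b-inc with compare (a zero) (b zero)
  ... | tri< a₀<b₀ _ _ = prepend-left a b a-inc (below-head b b-inc a₀<b₀)
          (union (a ∘ suc) b (a-inc ∘ s≤s) b-inc)
  ... | tri≈ _ a₀≡b₀ _ = prepend-both a b a-inc b-inc a₀≡b₀
          (union (a ∘ suc) (b ∘ suc) (a-inc ∘ s≤s) (b-inc ∘ s≤s))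
  ... | tri> _ _ b₀<a₀ = swap-union (prepend-left b a b-inc (below-head a a-inc b₀<a₀)
          (swap-union (union a (b ∘ suc) a-inc (b-inc ∘ s≤s))))

-- D^T(X) is a linear order, up to _≈D_, whenever X is a linear order and
-- D^T(X) embeds into X (which makes _<D_ irreflexive).
module LinearityOfD (P : PraeDilator) {A : Set} (_<_ : Rel A 0ℓ)
  (A-order : IsStrictTotalOrder _≡_ _<_)
  (ξ : DT P _<_ → A) (ξ-mono : IsOrderEmbedding (_<D_ P _<_) _<_ ξ) where

  open PraeDilator P
  open Unions A-order
  open Union

  D : Set
  D = DT P _<_

  _<ᴰ_ _≈ᴰ_ : Rel D 0ℓ
  _<ᴰ_ = _<D_ P _<_
  _≈ᴰ_ = _≈D_ P _<_

  <ᴰ-irrefl : ∀ {d} → ¬ d <ᴰ d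
  <ᴰ-irrefl {d} d<d = IsStrictTotalOrder.irrefl A-order refl (ξ-mono {d} {d} d<d)

  via-union : ∀ d e (U : Union (en d) (en e)) →
    Lt (k U) (map (f U) (σ d)) (map (g U) (σ e)) → d <ᴰ e
  via-union d e U lt = k U , c U , c-inc U , f U , g U , c∘f U , c∘g U , covers U , lt

  -- By naturality of supports, since σ d has full support, the support of
  -- T(h)(σ d) is exactly the range of h.
  supp-image : ∀ (d : D) {m} (h : Mor (size d) m) l →
    l ∈ supp m (map h (σ d)) ⇔ (∃[ i ] fun h i ≡ l)
  supp-image d h l = mk⇔
    (λ l∈supp → let i , _ , hi≡l = Equivalence.to (supp-nat h (σ-fld d) l) l∈supp in i , hi≡l)
    (λ (i , hi≡l) → Equivalence.from (supp-nat h (σ-fld d) l)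
                      (i , subst (i ∈_) (sym (σ-supp d)) ∈⊤ , hi≡l))

  -- If the images of σ d and σ e along a union coincide, their supports
  -- coincide, so the index map of d is onto.
  equal-images-onto : ∀ d e (U : Union (en d) (en e)) →
    map (f U) (σ d) ≡ map (g U) (σ e) → ∀ l → ∃[ i ] fun (f U) i ≡ l
  equal-images-onto d e U images≡ l with covers U l
  ... | inj₁ from-d = from-d
  ... | inj₂ from-e = Equivalence.to (supp-image d (f U) l)
          (subst (λ τ → l ∈ supp (k U) τ) (sym images≡) (Equivalence.from (supp-image e (g U) l) from-e))

  -- Over the same enumeration, σ is determined by its image along an onto
  -- index map: a strict inequality would be transported by T(f) to e <ᴰ e.
  σ-determined : ∀ (d e : D) (p : size d ≡ size e) → (∀ i → en d i ≡ en e (subst Fin p i)) →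
    (U : Union (en d) (en e)) → (∀ l → ∃[ i ] fun (f U) i ≡ l) →
    map (f U) (σ d) ≡ map (g U) (σ e) → σ d ≡ σ e
  σ-determined ⟨ n , a , _ , s , s-fld , _ ⟩ e@(⟨ .n , b , _ , t , t-fld , _ ⟩) refl a≗b U f-onto images≡
    with Lt-conn s-fld t-fld
  ... | inj₂ (inj₁ s≡t) = s≡t
  ... | inj₁ s<t = ⊥-elim (<ᴰ-irrefl {e} (via-union e e U-twisted
          (subst (λ τ → Lt (k U) τ (map (f U) t)) images≡ (map-mono (f U) s<t))))
    where
    U-twisted : Union b b
    U-twisted = record { k = k U ; c = c U ; c-inc = c-inc U ; f = g U ; g = f U
      ; c∘f = c∘g U ; c∘g = λ i → trans (c∘f U i) (a≗b i) ; covers = λ l → inj₂ (f-onto l) }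
  ... | inj₂ (inj₂ t<s) = ⊥-elim (<ᴰ-irrefl {e} (via-union e e U-relabelled
          (subst (Lt (k U) (map (f U) t)) images≡ (map-mono (f U) t<s))))
    where
    U-relabelled : Union b b
    U-relabelled = record { k = k U ; c = c U ; c-inc = c-inc U ; f = f U ; g = g U
      ; c∘f = λ i → trans (c∘f U i) (a≗b i) ; c∘g = c∘g U ; covers = λ l → inj₁ (f-onto l) }

  -- Equal images along a union mean equal elements: both index maps are
  -- onto, hence identities, so d and e have the same support, and then σ's agree.
  equal-images : ∀ d e (U : Union (en d) (en e)) → map (f U) (σ d) ≡ map (g U) (σ e) → d ≈ᴰ e
  equal-images d e U images≡ = sizes≡ , en≗ , σ-determined d e sizes≡ en≗ U f-onto images≡
    where
    f-onto : ∀ l → ∃[ i ] fun (f U) i ≡ l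
    f-onto = equal-images-onto d e U images≡
    f-id : size d ≡ k U × (∀ i → toℕ (fun (f U) i) ≡ toℕ i)
    f-id = increasing-surjection-is-id (fun (f U)) (mono (f U)) f-onto
    g-id : size e ≡ k U × (∀ i → toℕ (fun (g U) i) ≡ toℕ i)
    g-id = increasing-surjection-is-id (fun (g U)) (mono (g U))
             (equal-images-onto e d (swap-union U) (sym images≡))
    sizes≡ : size d ≡ size e
    sizes≡ = trans (proj₁ f-id) (sym (proj₁ g-id))
    same-index : ∀ i → fun (f U) i ≡ fun (g U) (subst Fin sizes≡ i)
    same-index i = Fin.toℕ-injective (begin
      toℕ (fun (f U) i)                    ≡⟨ proj₂ f-id i ⟩
      toℕ i                                ≡⟨ sym (toℕ-subst sizes≡ i) ⟩
      toℕ (subst Fin sizes≡ i)             ≡⟨ sym (proj₂ g-id (subst Fin sizes≡ i)) ⟩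
      toℕ (fun (g U) (subst Fin sizes≡ i)) ∎)
      where open ≡-Reasoning
    en≗ : ∀ i → en d i ≡ en e (subst Fin sizes≡ i)
    en≗ i = begin
      en d i                               ≡⟨ sym (c∘f U i) ⟩
      c U (fun (f U) i)                    ≡⟨ cong (c U) (same-index i) ⟩
      c U (fun (g U) (subst Fin sizes≡ i)) ≡⟨ c∘g U (subst Fin sizes≡ i) ⟩
      en e (subst Fin sizes≡ i)            ∎
      where open ≡-Reasoning

  <ᴰ-compare : ∀ d e → d <ᴰ e ⊎ d ≈ᴰ e ⊎ e <ᴰ d
  <ᴰ-compare d e = compare-along (union (en d) (en e) (en-inc d) (en-inc e))
    where
    compare-along : Union (en d) (en e) → d <ᴰ e ⊎ d ≈ᴰ e ⊎ e <ᴰ d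
    compare-along U with Lt-conn (map-fld (f U) (σ-fld d)) (map-fld (g U) (σ-fld e))
    ... | inj₁ d<e = inj₁ (via-union d e U d<e)
    ... | inj₂ (inj₁ images≡) = inj₂ (inj₁ (equal-images d e U images≡))
    ... | inj₂ (inj₂ e<d) = inj₂ (inj₂ (via-union e d (swap-union U) e<d))

  ≈ᴰ-sym : ∀ {d e} → d ≈ᴰ e → e ≈ᴰ d
  ≈ᴰ-sym {⟨ n , _ , _ , _ , _ , _ ⟩} {⟨ .n , _ , _ , _ , _ , _ ⟩} (refl , en≗ , σ≡) =
    refl , (λ i → sym (en≗ i)) , sym σ≡

  <ᴰ-respˡ : ∀ {d d′ e} → d ≈ᴰ d′ → d <ᴰ e → d′ <ᴰ e
  <ᴰ-respˡ {⟨ n , _ , _ , _ , _ , _ ⟩} {⟨ .n , _ , _ , _ , _ , _ ⟩} (refl , en≗ , refl)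
    (k , c , c-inc , f , g , c∘f , c∘g , covers , lt) =
    k , c , c-inc , f , g , (λ i → trans (c∘f i) (en≗ i)) , c∘g , covers , lt

  <ᴰ-respʳ : ∀ {d e e′} → e ≈ᴰ e′ → d <ᴰ e → d <ᴰ e′
  <ᴰ-respʳ {_} {⟨ n , _ , _ , _ , _ , _ ⟩} {⟨ .n , _ , _ , _ , _ , _ ⟩} (refl , en≗ , refl)
    (k , c , c-inc , f , g , c∘f , c∘g , covers , lt) =
    k , c , c-inc , f , g , c∘f , (λ i → trans (c∘g i) (en≗ i)) , covers , lt

nonempty-subset-of-one : (s : Subset 1) → ¬ (∀ j → j ∈ s → toℕ j ℕ.< 0) → s ≡ ⊤
nonempty-subset-of-one (true ∷ [])  _ = refl
nonempty-subset-of-one (false ∷ []) s-not-empty = ⊥-elim (s-not-empty λ { zero () })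

-- For a normal prae-dilator, x ↦ ⟨{x}, μ₁(0)⟩ embeds X into D^T(X): the
-- singletons of x < y compare in T(2) as μ₂(0) < μ₂(1).
singleton-embedding : (P : PraeDilator) → IsNormal P → {A : Set} (_<_ : Rel A 0ℓ) →
  Σ (A → DT P _<_) (IsOrderEmbedding _<_ (_<D_ P _<_))
singleton-embedding P (μ , μ-fld , μ-mono , μ-nat , μ-supp) {A} _<_ = singleton , singleton-mono
  where
  open PraeDilator P

  -- μ₁(0) has full support, since it is not below itself.
  μ-full : supp 1 (μ 1 zero) ≡ ⊤
  μ-full = nonempty-subset-of-one (supp 1 (μ 1 zero))
    (λ supp-empty → Lt-irr (Equivalence.from (μ-supp 1 (μ-fld 1 zero) zero) supp-empty))

  singleton : A → DT P _<_
  singleton x = ⟨ 1 , (λ _ → x) , (λ { {zero} {zero} () }) , μ 1 zero , μ-fld 1 zero , μ-full ⟩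

  first second : Mor 1 2
  first  = record { fun = λ _ → zero     ; mono = λ { {zero} {zero} () } }
  second = record { fun = λ _ → suc zero ; mono = λ { {zero} {zero} () } }

  singleton-mono : IsOrderEmbedding _<_ (_<D_ P _<_) singleton
  singleton-mono {x} {y} x<y =
    2 , pair , pair-inc , first , second , (λ { zero → refl }) , (λ { zero → refl }) , covers ,
    subst₂ (Lt 2) (sym (μ-nat first zero)) (sym (μ-nat second zero)) (μ-mono 2 (s≤s z≤n))
    where
    pair : Fin 2 → A
    pair zero    = x
    pair (suc _) = y
    pair-inc : ∀ {i j} → i Fin.< j → pair i < pair j
    pair-inc {zero}     {zero}     ()
    pair-inc {zero}     {suc zero} _ = x<y
    pair-inc {suc zero} {zero}     ()
    pair-inc {suc zero} {suc zero} (s≤s ())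
    covers : ∀ l → (∃[ i ] fun first i ≡ l) ⊎ (∃[ i ] fun second i ≡ l)
    covers zero       = inj₁ (zero , refl)
    covers (suc zero) = inj₂ (zero , refl)

corollary2p13 : ExcludedMiddle 0ℓ →
    (P : PraeDilator) → IsDilator P → IsNormal P →
    (A : Set) (_<_ : Rel A 0ℓ) → IsWellOrder _<_ →
    (ξ : DT P _<_ → A) → IsOrderEmbedding (_<D_ P _<_) _<_ ξ →
    OrderIso _<_ (_<D_ P _<_) (_≈D_ P _<_)
corollary2p13 lem P _ normal A _<_ (A-order , A-wf) ξ ξ-mono = isomorphic
  where
  open LinearityOfD P _<_ A-order ξ ξ-mono
  ι : Σ (A → DT P _<_) (IsOrderEmbedding _<_ _<ᴰ_)
  ι = singleton-embedding P normal _<_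
  -- _<ᴰ_ and _≈ᴰ_ unfold to Σ-types, so implicit arguments are passed explicitly.
  open Comparison lem _<_ A-order A-wf _<ᴰ_ _≈ᴰ_ <ᴰ-compare
         (λ {d} {e} → ≈ᴰ-sym {d} {e})
         (λ {d} {d′} {e} → <ᴰ-respˡ {d} {d′} {e})
         (λ {d} {e} {e′} → <ᴰ-respʳ {d} {e} {e′})
         (proj₁ ι) (proj₂ ι) ξ ξ-mono
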